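{- Let $n\geq 5$ be an integer. Then $\big|\mathcal{A}^\circ_n(2431; 1324)\big|_2^2\big|_3^n\big| = \big|\mathcal{A}^\circ_{n-2}(2431; 1324)\big|$.
   Context: Let $S_n$ be the symmetric group on $[n]=\{1,\dots,n\}$. A permutation $\pi\in S_n$ has one-line form $\pi_1\pi_2\cdots\pi_n$ with $\pi_i=\pi(i)$. For a word $w=w_1\cdots w_n$ of distinct integers and $\tau=\tau_1\cdots\tau_k\in S_k$, $w$ contains $\tau$ if there are indices $i_1<\cdots<i_k$ with $w_{i_s}>w_{i_t}$ iff $\tau_s>\tau_t$ for all $1\le s<t\le k$; otherwise $w$ avoids $\tau$. A permutation $\pi\in S_n$ is a cyclic permutation if it consists of a single $n$-cycle $\pi=(c_1,\dots,c_n)$ (meaning $\pi(c_i)=c_{i+1}$ for $i<n$, $\pi(c_n)=c_1$). Its cycle forms are the words $c_ic_{i+1}\cdots c_nc_1\cdots c_{i-1}$, $1\le i\le n$; the standard cycle form is the one with first entry $1$. $\mathcal{A}^\circ_n(\sigma;\tau)$ is the set of cyclic permutations in $S_n$ whose one-line form avoids $\sigma$ and all of whose cycle forms avoid $\tau$. For $3\le j\le n$, $\mathcal{A}^\circ_n(\sigma;\tau)\big|_2^2\big|_3^j$ is the set of $\pi\in\mathcal{A}^\circ_n(\sigma;\tau)$ whose standard cycle form is $(1,2,c_3,\dots,c_{j-1},3,c_{j+1},\dots,c_n)$, i.e. has $2$ in position $2$ and $3$ in position $j$. -}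

module Defs where

open import Data.Nat using (ℕ; zero; suc; _∸_; _≡ᵇ_; _<ᵇ_)
open import Data.Bool using (Bool; true; false; not; _∧_; T)
open import Data.List using (List; []; _∷_; map; upTo; length; zip; drop; take; _++_)
open import Data.Bool.ListAction using (any; all)
open import Data.Product using (Σ; _×_; _,_)

-- All permutations of [n] are represented by their one-line form
-- π₁π₂⋯πₙ, a list of natural numbers (values 1..n).

range : ℕ → List ℕ
range n = map suc (upTo n)

elem : ℕ → List ℕ → Bool
elem x = any (λ y → x ≡ᵇ y)

distinct : List ℕ → Bool
distinct [] = true
distinct (x ∷ xs) = not (elem x xs) ∧ distinct xs

isPerm : ℕ → List ℕ → Bool
isPerm n w = (length w ≡ᵇ n) ∧ (distinct w ∧ all (λ x → elem x (range n)) w)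

-- 0-based list lookup with default 0
nth : List ℕ → ℕ → ℕ
nth [] _ = 0
nth (x ∷ xs) zero = x
nth (x ∷ xs) (suc i) = nth xs i

-- π(i) for π with one-line form w  (π(i) = w_i, 1-based)
app : List ℕ → ℕ → ℕ
app w i = nth w (i ∸ 1)

orbit : List ℕ → ℕ → ℕ → List ℕ
orbit w c zero = []
orbit w c (suc k) = c ∷ orbit w (app w c) k

-- standard cycle form (first entry 1) of a permutation in S_n
stdCycle : ℕ → List ℕ → List ℕ
stdCycle n w = orbit w 1 n

isCyclic : ℕ → List ℕ → Bool
isCyclic n w = isPerm n w ∧ distinct (stdCycle n w)

-- all cycle forms c_i ⋯ c_n c_1 ⋯ c_{i-1}  (rotations of a cycle form)
cycleForms : List ℕ → List (List ℕ)
cycleForms c = map (λ i → drop i c ++ take i c) (upTo (length c))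

subseqs : ℕ → List ℕ → List (List ℕ)
subseqs zero _ = [] ∷ []
subseqs (suc k) [] = []
subseqs (suc k) (x ∷ xs) = map (x ∷_) (subseqs k xs) ++ subseqs (suc k) xs

-- s and t (same length) are order-isomorphic:
-- for all positions p < q,  s_p > s_q  iff  t_p > t_q
eqB : Bool → Bool → Bool
eqB true b = b
eqB false b = not b

sameOrder : List ℕ → List ℕ → Bool
sameOrder (x ∷ xs) (y ∷ ys) =
  all (λ { (a , b) → eqB (a <ᵇ x) (b <ᵇ y) }) (zip xs ys) ∧ sameOrder xs ys
sameOrder _ _ = true

contains : List ℕ → List ℕ → Bool
contains w τ = any (λ s → sameOrder s τ) (subseqs (length τ) w)

avoids : List ℕ → List ℕ → Bool
avoids w τ = not (contains w τ)

inA : ℕ → List ℕ → List ℕ → List ℕ → Bool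
inA n σ τ w = isCyclic n w ∧ (avoids w σ ∧ all (λ c → avoids c τ) (cycleForms (stdCycle n w)))

A° : ℕ → List ℕ → List ℕ → Set
A° n σ τ = Σ (List ℕ) (λ w → T (inA n σ τ w))

-- standard cycle form has 2 in position 2 and 3 in position j
restr : ℕ → ℕ → List ℕ → Bool
restr n j w = (nth (stdCycle n w) 1 ≡ᵇ 2) ∧ (nth (stdCycle n w) (j ∸ 1) ≡ᵇ 3)

A°restr : ℕ → List ℕ → List ℕ → ℕ → Set
A°restr n σ τ j = Σ (List ℕ) (λ w → T (inA n σ τ w ∧ restr n j w))

p2431 : List ℕ
p2431 = 2 ∷ 4 ∷ 3 ∷ 1 ∷ []

p1324 : List ℕ
p1324 = 1 ∷ 3 ∷ 2 ∷ 4 ∷ []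

-- Write m = n − 2. A cyclic π ∈ S_m with standard cycle form (1, c₂, …, cₘ) is sent to the permutation with
-- cycle form (1, 2, c₂+2, …, cₘ+2, 3), whose one-line form is 2 (π₁+2) 1 (π₂+2) ⋯ (πₘ+2). Conversely, a member
-- of the restricted set maps 1 ↦ 2 and, its cycle closing right after 3, maps 3 ↦ 1, so it arises in this way.
-- The inserted letters 2 and 1, at positions 1 and 3 and below all other letters, never take part in an
-- occurrence of 2431. In a rotation of the grown cycle the letters 3, 1, 2 are cyclically consecutive and below
-- all others; two of them cannot both take part in an occurrence of 1324 (its two smallest letters are not
-- adjacent) and a single one may be replaced by 3, so the block 3 1 2 collapses to 3, the shifted copy of 1.
-- The rotations starting inside the block are handled by dropping the trailing 3 (resp. 3 1), which would have
-- to be the largest letter of an occurrence.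

module Submission where

open import Defs
open import Data.Nat using (ℕ; zero; suc; _+_; _∸_; _≡ᵇ_; _<ᵇ_; _≤_; _<_; z≤n; s≤s; s≤s⁻¹)
open import Data.Nat.Properties
  using (≡ᵇ⇒≡; ≡⇒≡ᵇ; <⇒<ᵇ; <ᵇ⇒<; m+[n∸m]≡n; m+n∸m≡n; +-comm; +-suc; +-monoʳ-≤; +-cancelˡ-≤; m≤n+m; ≤-refl; ≤-trans;
         ≤-reflexive; <-irrefl; <-≤-trans; <⇒≤; n≤1+n; m≤n⇒m<n∨m≡n; suc-injective)
open import Data.Bool using (Bool; true; false; not; _∧_; _∨_; T)
open import Data.Bool.Properties
  using (not-¬; not-injective; T-≡; T-∧; T-irrelevant; ∨-assoc; ∨-zeroʳ; ∧-conicalˡ; ∧-conicalʳ; ∨-conicalˡ; ∨-conicalʳ)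
open import Data.Bool.ListAction using (any; all)
open import Data.List using (List; []; _∷_; map; upTo; length; zip; drop; take; _++_)
open import Data.List.Properties
  using (++-assoc; ++-identityʳ; length-++; length-map; map-++; drop-all; take-all; drop-map; take-map; length-applyUpTo; applyUpTo-∷ʳ)
open import Data.Empty using (⊥-elim)
open import Data.List.Relation.Unary.All as All using (All; []; _∷_)
open import Data.List.Relation.Unary.All.Properties using (map⁻; applyUpTo⁺₁; applyUpTo⁻; map⁺; ++⁺; drop⁺; take⁺)
open import Data.Sum using (_⊎_; inj₁; inj₂)
open import Data.Product using (Σ; _×_; _,_; proj₁; proj₂; uncurry)
open import Function.Bundles using (_↔_; mk↔ₛ′; Equivalence)
open import Relation.Binary.PropositionalEquality using (_≡_; _≢_; refl; sym; trans; cong; cong₂; subst; module ≡-Reasoning)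
open ≡-Reasoning

∧-intro : ∀ {a b} → a ≡ true → b ≡ true → a ∧ b ≡ true
∧-intro refl refl = refl

∨-true⁻ : ∀ a {b} → a ∨ b ≡ true → a ≡ true ⊎ b ≡ true
∨-true⁻ true  _ = inj₁ refl
∨-true⁻ false e = inj₂ e

∨-false⁺ : ∀ {a b} → a ≡ false → b ≡ false → a ∨ b ≡ false
∨-false⁺ refl refl = refl

∨-dup : ∀ a b → a ∨ (a ∨ b) ≡ a ∨ b
∨-dup true  b = refl
∨-dup false b = refl

≡ᵇ-true⇒≡ : ∀ x y → (x ≡ᵇ y) ≡ true → x ≡ y
≡ᵇ-true⇒≡ x y e = ≡ᵇ⇒≡ x y (Equivalence.from T-≡ e)

≡ᵇ-refl : ∀ x → (x ≡ᵇ x) ≡ true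
≡ᵇ-refl x = Equivalence.to T-≡ (≡⇒≡ᵇ x x refl)

≡ᵇ-sym : ∀ x y → (x ≡ᵇ y) ≡ (y ≡ᵇ x)
≡ᵇ-sym zero    zero    = refl
≡ᵇ-sym zero    (suc y) = refl
≡ᵇ-sym (suc x) zero    = refl
≡ᵇ-sym (suc x) (suc y) = ≡ᵇ-sym x y

≡ᵇ-+ : ∀ k x y → (k + x ≡ᵇ k + y) ≡ (x ≡ᵇ y)
≡ᵇ-+ zero    x y = refl
≡ᵇ-+ (suc k) x y = ≡ᵇ-+ k x y

<ᵇ-+ : ∀ k x y → (k + x <ᵇ k + y) ≡ (x <ᵇ y)
<ᵇ-+ zero    x y = refl
<ᵇ-+ (suc k) x y = <ᵇ-+ k x y

<⇒<ᵇ≡true : ∀ {m n} → m < n → (m <ᵇ n) ≡ true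
<⇒<ᵇ≡true m<n = Equivalence.to T-≡ (<⇒<ᵇ m<n)

≤⇒<ᵇ≡false : ∀ {m n} → n ≤ m → (m <ᵇ n) ≡ false
≤⇒<ᵇ≡false {m}     {zero}  _       = refl
≤⇒<ᵇ≡false {suc m} {suc n} (s≤s p) = ≤⇒<ᵇ≡false p

all⁻ : ∀ {A : Set} (p : A → Bool) xs → all p xs ≡ true → All (λ x → p x ≡ true) xs
all⁻ p []       _ = []
all⁻ p (x ∷ xs) e = ∧-conicalˡ _ _ e ∷ all⁻ p xs (∧-conicalʳ _ _ e)

all⁺ : ∀ {A : Set} {p : A → Bool} {xs} → All (λ x → p x ≡ true) xs → all p xs ≡ true
all⁺ []         = refl
all⁺ (px ∷ pxs) = ∧-intro px (all⁺ pxs)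

any-++ : ∀ {A : Set} (p : A → Bool) xs ys → any p (xs ++ ys) ≡ any p xs ∨ any p ys
any-++ p []       ys = refl
any-++ p (x ∷ xs) ys = trans (cong (p x ∨_) (any-++ p xs ys)) (sym (∨-assoc (p x) (any p xs) (any p ys)))

any-map : ∀ {A B : Set} (p : B → Bool) (f : A → B) xs → any p (map f xs) ≡ any (λ x → p (f x)) xs
any-map p f []       = refl
any-map p f (x ∷ xs) = cong (p (f x) ∨_) (any-map p f xs)

any-cong : ∀ {A : Set} {p q : A → Bool} → (∀ x → p x ≡ q x) → ∀ xs → any p xs ≡ any q xs
any-cong p≗q []       = refl
any-cong p≗q (x ∷ xs) = cong₂ _∨_ (p≗q x) (any-cong p≗q xs)

elem-++ : ∀ x xs ys → elem x (xs ++ ys) ≡ elem x xs ∨ elem x ys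
elem-++ x []       ys = refl
elem-++ x (y ∷ xs) ys with x ≡ᵇ y
... | true  = refl
... | false = elem-++ x xs ys

elem-map-+ : ∀ k x xs → elem (k + x) (map (k +_) xs) ≡ elem x xs
elem-map-+ k x []       = refl
elem-map-+ k x (y ∷ xs) = cong₂ _∨_ (≡ᵇ-+ k x y) (elem-map-+ k x xs)

distinct-map-+ : ∀ k xs → distinct (map (k +_) xs) ≡ distinct xs
distinct-map-+ k []       = refl
distinct-map-+ k (x ∷ xs) = cong₂ (λ a b → not a ∧ b) (elem-map-+ k x xs) (distinct-map-+ k xs)

nth-map : ∀ (f : ℕ → ℕ) xs {i} → i < length xs → nth (map f xs) i ≡ f (nth xs i)
nth-map f (x ∷ xs) {zero}  _       = refl
nth-map f (x ∷ xs) {suc i} (s≤s p) = nth-map f xs p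

nth-++-length : ∀ xs y ys → nth (xs ++ y ∷ ys) (length xs) ≡ y
nth-++-length []       y ys = refl
nth-++-length (x ∷ xs) y ys = nth-++-length xs y ys

nth-elem : ∀ xs {i} → i < length xs → elem (nth xs i) xs ≡ true
nth-elem (x ∷ xs) {zero}  _       rewrite ≡ᵇ-refl x = refl
nth-elem (x ∷ xs) {suc i} (s≤s p) with nth xs i ≡ᵇ x
... | true  = refl
... | false = nth-elem xs p

elem⇒nth : ∀ x xs → elem x xs ≡ true → Σ ℕ λ i → i < length xs × nth xs i ≡ x
elem⇒nth x (y ∷ xs) e with x ≡ᵇ y in x≡ᵇy
... | true  = zero , s≤s z≤n , sym (≡ᵇ-true⇒≡ x y x≡ᵇy)
... | false with elem⇒nth x xs e
...   | i , i<len , eq = suc i , s≤s i<len , eq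

all-nth : ∀ (p : ℕ → Bool) xs {i} → all p xs ≡ true → i < length xs → p (nth xs i) ≡ true
all-nth p (x ∷ xs) {zero}  a _       = ∧-conicalˡ (p x) _ a
all-nth p (x ∷ xs) {suc i} a (s≤s q) = all-nth p xs (∧-conicalʳ (p x) _ a) q

distinct-head : ∀ x xs → distinct (x ∷ xs) ≡ true → elem x xs ≡ false
distinct-head x xs d = not-injective (∧-conicalˡ (not (elem x xs)) _ d)

distinct-tail : ∀ x xs → distinct (x ∷ xs) ≡ true → distinct xs ≡ true
distinct-tail x xs d = ∧-conicalʳ (not (elem x xs)) _ d

head-not-repeated : ∀ x xs {j} → distinct (x ∷ xs) ≡ true → j < length xs → x ≢ nth xs j
head-not-repeated x xs d j<len x≡xⱼ
  with trans (sym (distinct-head x xs d)) (subst (λ z → elem z xs ≡ true) (sym x≡xⱼ) (nth-elem xs j<len))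
... | ()

distinct⇒nth-injective : ∀ xs {i j} → distinct xs ≡ true → i < length xs → j < length xs →
                         nth xs i ≡ nth xs j → i ≡ j
distinct⇒nth-injective (x ∷ xs) {zero}  {zero}  _ _       _       _ = refl
distinct⇒nth-injective (x ∷ xs) {zero}  {suc j} d _       (s≤s q) e = ⊥-elim (head-not-repeated x xs d q e)
distinct⇒nth-injective (x ∷ xs) {suc i} {zero}  d (s≤s p) _       e = ⊥-elim (head-not-repeated x xs d p (sym e))
distinct⇒nth-injective (x ∷ xs) {suc i} {suc j} d (s≤s p) (s≤s q) e =
  cong suc (distinct⇒nth-injective xs (distinct-tail x xs d) p q e)

distinct-++ˡ : ∀ xs ys → distinct (xs ++ ys) ≡ true → distinct xs ≡ true
distinct-++ˡ []       ys _ = refl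
distinct-++ˡ (x ∷ xs) ys d =
  ∧-intro (cong not (∨-conicalˡ (elem x xs) _ (trans (sym (elem-++ x xs ys)) (distinct-head x (xs ++ ys) d))))
          (distinct-++ˡ xs ys (distinct-tail x (xs ++ ys) d))

distinct-∷ʳ⁻ : ∀ xs y → distinct (xs ++ y ∷ []) ≡ true → elem y xs ≡ false
distinct-∷ʳ⁻ []       y _ = refl
distinct-∷ʳ⁻ (x ∷ xs) y d = ∨-false⁺ (trans (≡ᵇ-sym y x) x≢y) (distinct-∷ʳ⁻ xs y (distinct-tail x (xs ++ y ∷ []) d))
  where
  x≢y : (x ≡ᵇ y) ≡ false
  x≢y = ∨-conicalˡ (x ≡ᵇ y) _ (∨-conicalʳ (elem x xs) _ (trans (sym (elem-++ x xs (y ∷ []))) (distinct-head x (xs ++ y ∷ []) d)))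

distinct-∷ʳ⁺ : ∀ xs y → distinct xs ≡ true → elem y xs ≡ false → distinct (xs ++ y ∷ []) ≡ true
distinct-∷ʳ⁺ []       y _ _  = refl
distinct-∷ʳ⁺ (x ∷ xs) y d y∉ =
  ∧-intro (cong not (trans (elem-++ x xs (y ∷ []))
                           (∨-false⁺ (distinct-head x xs d) (∨-false⁺ (trans (≡ᵇ-sym x y) (∨-conicalˡ (y ≡ᵇ x) _ y∉)) refl))))
          (distinct-∷ʳ⁺ xs y (distinct-tail x xs d) (∨-conicalʳ (y ≡ᵇ x) _ y∉))

map-∸-+ : ∀ k xs → map (_∸ k) (map (k +_) xs) ≡ xs
map-∸-+ k []       = refl
map-∸-+ k (x ∷ xs) = cong₂ _∷_ (m+n∸m≡n k x) (map-∸-+ k xs)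

map-+-∸ : ∀ k xs → All (k ≤_) xs → map (k +_) (map (_∸ k) xs) ≡ xs
map-+-∸ k []       []           = refl
map-+-∸ k (x ∷ xs) (k≤x ∷ k≤xs) = cong₂ _∷_ (m+[n∸m]≡n k≤x) (map-+-∸ k xs k≤xs)

drop-++ˡ : ∀ j (xs ys : List ℕ) → j ≤ length xs → drop j (xs ++ ys) ≡ drop j xs ++ ys
drop-++ˡ zero    xs       ys _       = refl
drop-++ˡ (suc j) (x ∷ xs) ys (s≤s p) = drop-++ˡ j xs ys p

take-++ˡ : ∀ j (xs ys : List ℕ) → j ≤ length xs → take j (xs ++ ys) ≡ take j xs
take-++ˡ zero    xs       ys _       = refl
take-++ˡ (suc j) (x ∷ xs) ys (s≤s p) = cong (x ∷_) (take-++ˡ j xs ys p)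

-- Pigeonhole

remove : ℕ → List ℕ → List ℕ
remove z []       = []
remove z (x ∷ xs) with z ≡ᵇ x
... | true  = xs
... | false = x ∷ remove z xs

length-remove : ∀ z xs → elem z xs ≡ true → suc (length (remove z xs)) ≡ length xs
length-remove z (x ∷ xs) e with z ≡ᵇ x
... | true  = refl
... | false = cong suc (length-remove z xs e)

elem-remove : ∀ z y xs → elem y xs ≡ true → (y ≡ᵇ z) ≡ false → elem y (remove z xs) ≡ true
elem-remove z y (x ∷ xs) e y≢z with z ≡ᵇ x in z≡ᵇx
... | true rewrite ≡ᵇ-true⇒≡ z x z≡ᵇx | y≢z = e
... | false with y ≡ᵇ x
...   | true  = refl
...   | false = elem-remove z y xs e y≢z

⊆-remove : ∀ z xs ys → all (λ y → elem y xs) ys ≡ true → elem z ys ≡ false →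
           all (λ y → elem y (remove z xs)) ys ≡ true
⊆-remove z xs []       _ _   = refl
⊆-remove z xs (y ∷ ys) a z∉ =
  ∧-intro (elem-remove z y xs (∧-conicalˡ _ _ a) (trans (≡ᵇ-sym y z) (∨-conicalˡ _ _ z∉)))
          (⊆-remove z xs ys (∧-conicalʳ _ _ a) (∨-conicalʳ _ _ z∉))

distinct-⊆⇒length≤ : ∀ ys xs → distinct ys ≡ true → all (λ y → elem y xs) ys ≡ true → length ys ≤ length xs
distinct-⊆⇒length≤ []       xs _ _ = z≤n
distinct-⊆⇒length≤ (y ∷ ys) xs d a =
  subst (suc (length ys) ≤_) (length-remove y xs (∧-conicalˡ _ _ a))
    (s≤s (distinct-⊆⇒length≤ ys (remove y xs) (distinct-tail y ys d)
           (⊆-remove y xs ys (∧-conicalʳ _ _ a) (distinct-head y ys d))))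

distinct-⊆⇒covers : ∀ ys xs → distinct ys ≡ true → all (λ y → elem y xs) ys ≡ true → length xs ≤ length ys →
                    ∀ z → elem z xs ≡ true → elem z ys ≡ true
distinct-⊆⇒covers ys xs d a len z z∈xs with elem z ys in z∈ys
... | true  = refl
... | false = ⊥-elim (<-irrefl refl
  (subst (_≤ length (remove z xs)) (sym (length-remove z xs z∈xs))
    (≤-trans len (distinct-⊆⇒length≤ ys (remove z xs) d (⊆-remove z xs ys a z∈ys)))))

range-suc : ∀ n → range (suc n) ≡ range n ++ suc n ∷ []
range-suc n = trans (cong (map suc) (sym (applyUpTo-∷ʳ (λ x → x) n))) (map-++ suc (upTo n) (n ∷ []))

length-range : ∀ n → length (range n) ≡ n
length-range n = trans (length-map suc (upTo n)) (length-applyUpTo (λ x → x) n)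

∈range⇒ : ∀ n x → elem x (range n) ≡ true → 1 ≤ x × x ≤ n
∈range⇒ (suc n) x e
  with ∨-true⁻ (elem x (range n)) (trans (sym (elem-++ x (range n) _)) (subst (λ xs → elem x xs ≡ true) (range-suc n) e))
... | inj₁ x∈ = proj₁ (∈range⇒ n x x∈) , ≤-trans (proj₂ (∈range⇒ n x x∈)) (n≤1+n n)
... | inj₂ x≡ with ∨-true⁻ (x ≡ᵇ suc n) x≡
...   | inj₁ x≡ᵇ rewrite ≡ᵇ-true⇒≡ x (suc n) x≡ᵇ = s≤s z≤n , ≤-refl

∈range⇐ : ∀ n x → 1 ≤ x → x ≤ n → elem x (range n) ≡ true
∈range⇐ zero    (suc x) _ ()
∈range⇐ (suc n) x 1≤x x≤ =
  subst (λ xs → elem x xs ≡ true) (sym (range-suc n)) (trans (elem-++ x (range n) (suc n ∷ [])) last-or-earlier)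
  where
  last-or-earlier : elem x (range n) ∨ elem x (suc n ∷ []) ≡ true
  last-or-earlier with m≤n⇒m<n∨m≡n x≤
  ... | inj₁ (s≤s x≤n) rewrite ∈range⇐ n x 1≤x x≤n = refl
  ... | inj₂ refl rewrite ≡ᵇ-refl n = ∨-zeroʳ (elem (suc n) (range n))

⊆range⇒positive : ∀ m xs → all (λ x → elem x (range m)) xs ≡ true → All (1 ≤_) xs
⊆range⇒positive m xs a = All.map (λ {x} x∈ → proj₁ (∈range⇒ m x x∈)) (all⁻ _ xs a)

positive⇒∉0 : ∀ {xs} → All (1 ≤_) xs → elem 0 xs ≡ false
positive⇒∉0 []               = refl
positive⇒∉0 (s≤s z≤n ∷ pos) = positive⇒∉0 pos

positive-∉1⇒≥2 : ∀ xs → All (1 ≤_) xs → elem 1 xs ≡ false → All (2 ≤_) xs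
positive-∉1⇒≥2 []                 []         _  = []
positive-∉1⇒≥2 (zero ∷ xs)        (() ∷ _)   _
positive-∉1⇒≥2 (suc zero ∷ xs)    _          ()
positive-∉1⇒≥2 (suc (suc x) ∷ xs) (_ ∷ pos) 1∉ = s≤s (s≤s z≤n) ∷ positive-∉1⇒≥2 xs pos 1∉

∈range-+ : ∀ k m x → elem x (range m) ≡ true → elem (k + x) (range (k + m)) ≡ true
∈range-+ k m x x∈ with ∈range⇒ m x x∈
... | 1≤x , x≤m = ∈range⇐ (k + m) (k + x) (≤-trans 1≤x (m≤n+m x k)) (+-monoʳ-≤ k x≤m)

∈range-+⁻ : ∀ k m x → elem (k + x) (range (k + m)) ≡ true → 1 ≤ x → elem x (range m) ≡ true
∈range-+⁻ k m x x∈ 1≤x = ∈range⇐ m x 1≤x (+-cancelˡ-≤ k x m (proj₂ (∈range⇒ (k + m) (k + x) x∈)))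

⊆range-+ : ∀ k m xs → all (λ x → elem x (range m)) xs ≡ true → all (λ x → elem x (range (k + m))) (map (k +_) xs) ≡ true
⊆range-+ k m []       _ = refl
⊆range-+ k m (x ∷ xs) a = ∧-intro (∈range-+ k m x (∧-conicalˡ _ _ a)) (⊆range-+ k m xs (∧-conicalʳ _ _ a))

⊆range-+⁻ : ∀ k m xs → all (λ x → elem x (range (k + m))) (map (k +_) xs) ≡ true → elem 0 xs ≡ false →
            all (λ x → elem x (range m)) xs ≡ true
⊆range-+⁻ k m []             _ _ = refl
⊆range-+⁻ k m (zero  ∷ xs)   _ ()
⊆range-+⁻ k m (suc x ∷ xs)   a 0∉ =
  ∧-intro (∈range-+⁻ k m (suc x) (∧-conicalˡ _ _ a) (s≤s z≤n)) (⊆range-+⁻ k m xs (∧-conicalʳ _ _ a) 0∉)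

-- Permutations and their orbits

record IsPermutation (n : ℕ) (w : List ℕ) : Set where
  field
    length≡   : length w ≡ n
    distinct≡ : distinct w ≡ true
    ⊆range    : all (λ x → elem x (range n)) w ≡ true
open IsPermutation

isPerm⇒ : ∀ n w → isPerm n w ≡ true → IsPermutation n w
isPerm⇒ n w e = record
  { length≡   = ≡ᵇ-true⇒≡ (length w) n (∧-conicalˡ (length w ≡ᵇ n) _ e)
  ; distinct≡ = ∧-conicalˡ (distinct w) _ (∧-conicalʳ (length w ≡ᵇ n) _ e)
  ; ⊆range    = ∧-conicalʳ (distinct w) _ (∧-conicalʳ (length w ≡ᵇ n) _ e)
  }

isPerm⇐ : ∀ n w → IsPermutation n w → isPerm n w ≡ true
isPerm⇐ n w π = ∧-intro (subst (λ k → (k ≡ᵇ n) ≡ true) (sym (length≡ π)) (≡ᵇ-refl n)) (∧-intro (distinct≡ π) (⊆range π))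

iter : List ℕ → ℕ → ℕ → ℕ
iter w zero    x = x
iter w (suc k) x = app w (iter w k x)

iter-suc : ∀ w k x → iter w k (app w x) ≡ iter w (suc k) x
iter-suc w zero    x = refl
iter-suc w (suc k) x = cong (app w) (iter-suc w k x)

length-orbit : ∀ w x k → length (orbit w x k) ≡ k
length-orbit w x zero    = refl
length-orbit w x (suc k) = cong suc (length-orbit w (app w x) k)

nth-orbit : ∀ w x {k i} → i < k → nth (orbit w x k) i ≡ iter w i x
nth-orbit w x {suc k} {zero}  _       = refl
nth-orbit w x {suc k} {suc i} (s≤s p) = trans (nth-orbit w (app w x) p) (iter-suc w i x)

orbit-∷ʳ : ∀ w x k → orbit w x (suc k) ≡ orbit w x k ++ iter w k x ∷ []
orbit-∷ʳ w x zero    = refl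
orbit-∷ʳ w x (suc k) =
  cong (x ∷_) (trans (orbit-∷ʳ w (app w x) k) (cong (λ z → orbit w (app w x) k ++ z ∷ []) (iter-suc w k x)))

module _ {n w} (π : IsPermutation n w) where

  app-∈range : ∀ x → elem x (range n) ≡ true → elem (app w x) (range n) ≡ true
  app-∈range x x∈ with ∈range⇒ n x x∈
  ... | s≤s {_} {x'} z≤n , x≤n = all-nth _ w (⊆range π) (subst (x' <_) (sym (length≡ π)) x≤n)

  iter-∈range : ∀ k x → elem x (range n) ≡ true → elem (iter w k x) (range n) ≡ true
  iter-∈range zero    x x∈ = x∈
  iter-∈range (suc k) x x∈ = app-∈range (iter w k x) (iter-∈range k x x∈)

  orbit-⊆range : ∀ k x → elem x (range n) ≡ true → all (λ y → elem y (range n)) (orbit w x k) ≡ true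
  orbit-⊆range zero    x x∈ = refl
  orbit-⊆range (suc k) x x∈ = ∧-intro x∈ (orbit-⊆range k (app w x) (app-∈range x x∈))

  app-injective : ∀ x y → elem x (range n) ≡ true → elem y (range n) ≡ true → app w x ≡ app w y → x ≡ y
  app-injective x y x∈ y∈ e with ∈range⇒ n x x∈ | ∈range⇒ n y y∈
  ... | s≤s {_} {x'} z≤n , x≤n | s≤s {_} {y'} z≤n , y≤n =
    cong suc (distinct⇒nth-injective w (distinct≡ π) (subst (x' <_) (sym (length≡ π)) x≤n)
                                                     (subst (y' <_) (sym (length≡ π)) y≤n) e)

-- The distinct orbit exhausts [1, n], so πⁿ(x) = πⁱ(x) for some i < n, and injectivity of π forces i = 0.
orbit-closes : ∀ {n w} → IsPermutation n w → ∀ x → elem x (range n) ≡ true → distinct (orbit w x n) ≡ true →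
               iter w n x ≡ x
orbit-closes {zero}      π x x∈ d = refl
orbit-closes {suc m} {w} π x x∈ d with elem⇒nth _ (orbit w x (suc m)) covered
  where
  covered : elem (iter w (suc m) x) (orbit w x (suc m)) ≡ true
  covered = distinct-⊆⇒covers (orbit w x (suc m)) (range (suc m)) d (orbit-⊆range π (suc m) x x∈)
              (≤-reflexive (trans (length-range (suc m)) (sym (length-orbit w x (suc m)))))
              (iter w (suc m) x) (iter-∈range π (suc m) x x∈)
... | zero   , _   , eq = sym eq
... | suc i  , i<  , eq = ⊥-elim (<-irrefl i≡m i<m)
  where
  i<m : i < m
  i<m = s≤s⁻¹ (subst (suc i <_) (length-orbit w x (suc m)) i<)
  iterᵢ≡iterₘ : iter w i x ≡ iter w m x
  iterᵢ≡iterₘ = app-injective π _ _ (iter-∈range π i x x∈) (iter-∈range π m x x∈)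
                  (trans (sym (nth-orbit w x (s≤s i<m))) eq)
  i≡m : i ≡ m
  i≡m = distinct⇒nth-injective (orbit w x (suc m)) d
          (subst (i <_) (sym (length-orbit w x (suc m))) (≤-trans i<m (n≤1+n m)))
          (subst (m <_) (sym (length-orbit w x (suc m))) ≤-refl)
          (trans (nth-orbit w x (≤-trans i<m (n≤1+n m))) (trans iterᵢ≡iterₘ (sym (nth-orbit w x {suc m} {m} ≤-refl))))

-- Growing a permutation by two

grow : List ℕ → List ℕ
grow []        = []
grow (v₁ ∷ vs) = 2 ∷ 2 + v₁ ∷ 1 ∷ map (2 +_) vs

shrink : List ℕ → List ℕ
shrink (_ ∷ b ∷ _ ∷ r) = map (_∸ 2) (b ∷ r)
shrink _               = []

shrink-grow : ∀ v → shrink (grow v) ≡ v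
shrink-grow []        = refl
shrink-grow (v₁ ∷ vs) = cong (v₁ ∷_) (map-∸-+ 2 vs)

1∉map-2+ : ∀ xs → elem 1 (map (2 +_) xs) ≡ false
1∉map-2+ []       = refl
1∉map-2+ (x ∷ xs) = 1∉map-2+ xs

distinct-grow : ∀ v₁ vs → distinct (grow (v₁ ∷ vs)) ≡ not (elem 0 (v₁ ∷ vs)) ∧ distinct (v₁ ∷ vs)
distinct-grow v₁ vs rewrite elem-map-+ 2 0 vs | 1∉map-2+ vs | elem-map-+ 2 v₁ vs | distinct-map-+ 2 vs = refl

grow-isPermutation : ∀ {m v₁ vs} → IsPermutation m (v₁ ∷ vs) → IsPermutation (2 + m) (grow (v₁ ∷ vs))
grow-isPermutation {m} {v₁} {vs} π = record
  { length≡   = cong (2 +_) (trans (cong suc (length-map (2 +_) vs)) (length≡ π))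
  ; distinct≡ = trans (distinct-grow v₁ vs)
                      (cong₂ (λ a b → not a ∧ b) (positive⇒∉0 (⊆range⇒positive m (v₁ ∷ vs) (⊆range π))) (distinct≡ π))
  ; ⊆range    = ∧-intro (∈range⇐ (2 + m) 2 (s≤s z≤n) (s≤s (s≤s z≤n)))
                (∧-intro (∈range-+ 2 m v₁ (∧-conicalˡ _ _ (⊆range π)))
                (∧-intro (∈range⇐ (2 + m) 1 (s≤s z≤n) (s≤s z≤n))
                         (⊆range-+ 2 m vs (∧-conicalʳ _ _ (⊆range π)))))
  }

grow-isPermutation⁻ : ∀ {m v₁ vs} → IsPermutation (2 + m) (grow (v₁ ∷ vs)) → IsPermutation m (v₁ ∷ vs)
grow-isPermutation⁻ {m} {v₁} {vs} π = record
  { length≡   = trans (cong suc (sym (length-map (2 +_) vs))) (suc-injective (suc-injective (length≡ π)))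
  ; distinct≡ = ∧-conicalʳ (not (elem 0 (v₁ ∷ vs))) _ distinct-v
  ; ⊆range    = ⊆range-+⁻ 2 m (v₁ ∷ vs) ⊆range-shifted 0∉v
  }
  where
  ⊆range-tail : all (λ x → elem x (range (2 + m))) (2 + v₁ ∷ 1 ∷ map (2 +_) vs) ≡ true
  ⊆range-tail = ∧-conicalʳ (elem 2 (range (2 + m))) _ (⊆range π)
  ⊆range-shifted : all (λ x → elem x (range (2 + m))) (map (2 +_) (v₁ ∷ vs)) ≡ true
  ⊆range-shifted = ∧-intro (∧-conicalˡ (elem (2 + v₁) (range (2 + m))) _ ⊆range-tail)
                           (∧-conicalʳ (elem 1 (range (2 + m))) _ (∧-conicalʳ (elem (2 + v₁) (range (2 + m))) _ ⊆range-tail))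
  distinct-v : not (elem 0 (v₁ ∷ vs)) ∧ distinct (v₁ ∷ vs) ≡ true
  distinct-v = trans (sym (distinct-grow v₁ vs)) (distinct≡ π)
  0∉v : elem 0 (v₁ ∷ vs) ≡ false
  0∉v = not-injective (∧-conicalˡ (not (elem 0 (v₁ ∷ vs))) _ distinct-v)

app-grow : ∀ v₁ vs y → 2 ≤ y → y ≤ length (v₁ ∷ vs) → app (grow (v₁ ∷ vs)) (2 + y) ≡ 2 + app (v₁ ∷ vs) y
app-grow v₁ vs (suc (suc j)) _         (s≤s j<len) = nth-map (2 +_) vs j<len
app-grow v₁ vs (suc zero)    (s≤s ()) _

module _ {m v₁ vs} (π : IsPermutation m (v₁ ∷ vs)) where
  private
    v = v₁ ∷ vs

    app-grow-∈range : ∀ j → elem (2 + j) (range m) ≡ true → app (grow v) (4 + j) ≡ 2 + app v (2 + j)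
    app-grow-∈range j y∈ =
      app-grow v₁ vs (2 + j) (s≤s (s≤s z≤n)) (subst (2 + j ≤_) (sym (length≡ π)) (proj₂ (∈range⇒ m (2 + j) y∈)))

  orbit-grow : ∀ k y → elem y (range m) ≡ true → elem 1 (orbit v y k) ≡ false →
               orbit (grow v) (2 + y) (suc k) ≡ map (2 +_) (orbit v y (suc k))
  orbit-grow zero    y             _  _  = refl
  orbit-grow (suc k) zero          y∈ _  with () ← proj₁ (∈range⇒ m 0 y∈)
  orbit-grow (suc k) (suc zero)    _  ()
  orbit-grow (suc k) (suc (suc j)) y∈ 1∉ rewrite app-grow-∈range j y∈ =
    cong (4 + j ∷_) (orbit-grow k (app v (2 + j)) (app-∈range π (2 + j) y∈) 1∉)

  orbit-grow⁻ : ∀ k y → elem y (range m) ≡ true → elem 3 (orbit (grow v) (2 + y) k) ≡ false →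
                elem 1 (orbit v y k) ≡ false
  orbit-grow⁻ zero    y             _  _  = refl
  orbit-grow⁻ (suc k) zero          y∈ _  with () ← proj₁ (∈range⇒ m 0 y∈)
  orbit-grow⁻ (suc k) (suc zero)    _  ()
  orbit-grow⁻ (suc k) (suc (suc j)) y∈ 3∉ =
    orbit-grow⁻ k (app v (2 + j)) (app-∈range π (2 + j) y∈)
      (subst (λ z → elem 3 (orbit (grow v) z k) ≡ false) (app-grow-∈range j y∈) 3∉)

grownCycle : List ℕ → List ℕ
grownCycle cs = 1 ∷ 2 ∷ map (2 +_) cs ++ 3 ∷ []

distinct-grownCycle : ∀ cs → distinct cs ≡ true → elem 0 cs ≡ false → elem 1 cs ≡ false → distinct (grownCycle cs) ≡ true
distinct-grownCycle cs d 0∉ 1∉ =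
  ∧-intro (cong not 1∉tail)
  (∧-intro (cong not 2∉tail)
           (distinct-∷ʳ⁺ (map (2 +_) cs) 3 (trans (distinct-map-+ 2 cs) d) (trans (elem-map-+ 2 1 cs) 1∉)))
  where
  1∉tail : elem 1 (2 ∷ map (2 +_) cs ++ 3 ∷ []) ≡ false
  1∉tail = trans (elem-++ 1 (map (2 +_) cs) (3 ∷ [])) (cong (_∨ false) (1∉map-2+ cs))
  2∉tail : elem 2 (map (2 +_) cs ++ 3 ∷ []) ≡ false
  2∉tail = trans (elem-++ 2 (map (2 +_) cs) (3 ∷ [])) (cong (_∨ false) (trans (elem-map-+ 2 0 cs) 0∉))

distinct-grownCycle⁻ : ∀ cs → distinct (grownCycle cs) ≡ true → distinct cs ≡ true
distinct-grownCycle⁻ cs d =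
  trans (sym (distinct-map-+ 2 cs))
        (distinct-++ˡ (map (2 +_) cs) (3 ∷ [])
           (distinct-tail 2 (map (2 +_) cs ++ 3 ∷ []) (distinct-tail 1 (2 ∷ map (2 +_) cs ++ 3 ∷ []) d)))

module _ {m v₁ vs} (π : IsPermutation (suc m) (v₁ ∷ vs)) where
  private
    v = v₁ ∷ vs
    v₁∈ : elem v₁ (range (suc m)) ≡ true
    v₁∈ = ∧-conicalˡ (elem v₁ (range (suc m))) _ (⊆range π)

  stdCycle-grow : elem 1 (orbit v v₁ m) ≡ false → iter v (suc m) 1 ≡ 1 →
                  stdCycle (3 + m) (grow v) ≡ grownCycle (orbit v v₁ m)
  stdCycle-grow 1∉ closes = cong (λ cs → 1 ∷ 2 ∷ cs) (begin
    orbit (grow v) (2 + v₁) (suc m)                    ≡⟨ orbit-grow π m v₁ v₁∈ 1∉ ⟩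
    map (2 +_) (orbit v v₁ (suc m))                    ≡⟨ cong (map (2 +_)) (orbit-∷ʳ v v₁ m) ⟩
    map (2 +_) (orbit v v₁ m ++ iter v m v₁ ∷ [])      ≡⟨ map-++ (2 +_) (orbit v v₁ m) _ ⟩
    map (2 +_) (orbit v v₁ m) ++ 2 + iter v m v₁ ∷ []
      ≡⟨ cong (λ z → map (2 +_) (orbit v v₁ m) ++ 2 + z ∷ []) (trans (iter-suc v m 1) closes) ⟩
    map (2 +_) (orbit v v₁ m) ++ 3 ∷ []                ∎)

  cyclic-grow : distinct (stdCycle (suc m) v) ≡ true → stdCycle (3 + m) (grow v) ≡ grownCycle (orbit v v₁ m)
  cyclic-grow d = stdCycle-grow (distinct-head 1 (orbit v v₁ m) d) (orbit-closes π 1 (∈range⇐ (suc m) 1 ≤-refl (s≤s z≤n)) d)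

  cyclic-grow⁻ : distinct (stdCycle (3 + m) (grow v)) ≡ true → nth (stdCycle (3 + m) (grow v)) (2 + m) ≡ 3 →
                 elem 1 (orbit v v₁ m) ≡ false × iter v (suc m) 1 ≡ 1
  cyclic-grow⁻ d last≡3 = 1∉ , closes
    where
    O = orbit (grow v) (2 + v₁) m
    iterₘ≡3 : iter (grow v) m (2 + v₁) ≡ 3
    iterₘ≡3 = trans (sym (nth-orbit (grow v) (2 + v₁) {suc m} {m} ≤-refl)) last≡3
    3∉ : elem 3 O ≡ false
    3∉ = distinct-∷ʳ⁻ O 3 (subst (λ cs → distinct cs ≡ true)
           (trans (orbit-∷ʳ (grow v) (2 + v₁) m) (cong (λ z → O ++ z ∷ []) iterₘ≡3))
           (distinct-tail 2 (orbit (grow v) (2 + v₁) (suc m)) (distinct-tail 1 (2 ∷ orbit (grow v) (2 + v₁) (suc m)) d)))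
    1∉ : elem 1 (orbit v v₁ m) ≡ false
    1∉ = orbit-grow⁻ π m v₁ v₁∈ 3∉
    3≡2+iterₘ : 3 ≡ 2 + iter v m v₁
    3≡2+iterₘ = begin
      3                                             ≡⟨ sym last≡3 ⟩
      nth (orbit (grow v) (2 + v₁) (suc m)) m       ≡⟨ cong (λ cs → nth cs m) (orbit-grow π m v₁ v₁∈ 1∉) ⟩
      nth (map (2 +_) (orbit v v₁ (suc m))) m
        ≡⟨ nth-map (2 +_) (orbit v v₁ (suc m)) (subst (m <_) (sym (length-orbit v v₁ (suc m))) ≤-refl) ⟩
      2 + nth (orbit v v₁ (suc m)) m                ≡⟨ cong (2 +_) (nth-orbit v v₁ {suc m} {m} ≤-refl) ⟩
      2 + iter v m v₁                               ∎
    closes : iter v (suc m) 1 ≡ 1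
    closes = trans (sym (iter-suc v m 1)) (sym (suc-injective (suc-injective 3≡2+iterₘ)))

-- Subsequences and order-isomorphism

occurs : List ℕ → List ℕ → Bool
occurs τ s = sameOrder s τ

-- `contains w τ` unfolds to `anySubseq (length τ) (occurs τ) w`.
anySubseq : ℕ → (List ℕ → Bool) → List ℕ → Bool
anySubseq k p w = any p (subseqs k w)

anySubseq-∷ : ∀ k p x w → anySubseq (suc k) p (x ∷ w) ≡ anySubseq k (λ s → p (x ∷ s)) w ∨ anySubseq (suc k) p w
anySubseq-∷ k p x w = trans (any-++ p (map (x ∷_) (subseqs k w)) (subseqs (suc k) w))
                            (cong (_∨ anySubseq (suc k) p w) (any-map p (x ∷_) (subseqs k w)))

module _ (P : ℕ → Set) where

  anySubseq-false : ∀ k p w → All P w → (∀ s → All P s → length s ≡ k → p s ≡ false) → anySubseq k p w ≡ false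
  anySubseq-false zero    p w       _          h = cong (_∨ false) (h [] [] refl)
  anySubseq-false (suc k) p []      _          h = refl
  anySubseq-false (suc k) p (x ∷ w) (px ∷ pw) h rewrite anySubseq-∷ k p x w =
    ∨-false⁺ (anySubseq-false k (λ s → p (x ∷ s)) w pw (λ s ps len → h (x ∷ s) (px ∷ ps) (cong suc len)))
             (anySubseq-false (suc k) p w pw h)

  anySubseq-cong : ∀ k p q w → All P w → (∀ s → All P s → length s ≡ k → p s ≡ q s) → anySubseq k p w ≡ anySubseq k q w
  anySubseq-cong zero    p q w       _          h = cong (_∨ false) (h [] [] refl)
  anySubseq-cong (suc k) p q []      _          h = refl
  anySubseq-cong (suc k) p q (x ∷ w) (px ∷ pw) h rewrite anySubseq-∷ k p x w | anySubseq-∷ k q x w =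
    cong₂ _∨_ (anySubseq-cong k (λ s → p (x ∷ s)) (λ s → q (x ∷ s)) w pw (λ s ps len → h (x ∷ s) (px ∷ ps) (cong suc len)))
              (anySubseq-cong (suc k) p q w pw h)

  anySubseq-skipHead : ∀ k p y w → All P w → (∀ s → All P s → suc (length s) ≡ k → p (y ∷ s) ≡ false) →
                       anySubseq k p (y ∷ w) ≡ anySubseq k p w
  anySubseq-skipHead zero    p y w _  _ = refl
  anySubseq-skipHead (suc k) p y w pw h rewrite anySubseq-∷ k p y w
                                              | anySubseq-false k (λ s → p (y ∷ s)) w pw (λ s ps len → h s ps (cong suc len)) = refl

  anySubseq-skipLast : ∀ k p y w → All P w → (∀ s → All P s → suc (length s) ≡ k → p (s ++ y ∷ []) ≡ false) →
                       anySubseq k p (w ++ y ∷ []) ≡ anySubseq k p w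
  anySubseq-skipLast zero          p y w       _          _ = refl
  anySubseq-skipLast (suc zero)    p y []      _          h rewrite h [] [] refl = refl
  anySubseq-skipLast (suc (suc k)) p y []      _          _ = refl
  anySubseq-skipLast (suc k)       p y (x ∷ w) (px ∷ pw) h
    rewrite anySubseq-∷ k p x (w ++ y ∷ []) | anySubseq-∷ k p x w
          | anySubseq-skipLast k (λ s → p (x ∷ s)) y w pw (λ s ps len → h (x ∷ s) (px ∷ ps) (cong suc len))
          | anySubseq-skipLast (suc k) p y w pw h = refl

anySubseq-map : ∀ (f : ℕ → ℕ) k p w → anySubseq k p (map f w) ≡ anySubseq k (λ s → p (map f s)) w
anySubseq-map f zero    p w       = refl
anySubseq-map f (suc k) p []      = refl
anySubseq-map f (suc k) p (x ∷ w)
  rewrite anySubseq-∷ k p (f x) (map f w) | anySubseq-∷ k (λ s → p (map f s)) x w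
        | anySubseq-map f k (λ s → p (f x ∷ s)) w | anySubseq-map f (suc k) p w = refl

anySubseq-∷-cong : ∀ k p x w w′ → anySubseq k (λ s → p (x ∷ s)) w ≡ anySubseq k (λ s → p (x ∷ s)) w′ →
                   anySubseq (suc k) p w ≡ anySubseq (suc k) p w′ → anySubseq (suc k) p (x ∷ w) ≡ anySubseq (suc k) p (x ∷ w′)
anySubseq-∷-cong k p x w w′ with-x without-x =
  trans (anySubseq-∷ k p x w) (trans (cong₂ _∨_ with-x without-x) (sym (anySubseq-∷ k p x w′)))

anySubseq-∷-false : ∀ k p x w → anySubseq (suc k) p (x ∷ w) ≡ false → anySubseq (suc k) p w ≡ false
anySubseq-∷-false k p x w e = ∨-conicalʳ (anySubseq k (λ s → p (x ∷ s)) w) _ (trans (sym (anySubseq-∷ k p x w)) e)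

-- `sameOrder (x ∷ s) (y ∷ t)` unfolds to `all (rowOrder x y) (zip s t) ∧ sameOrder s t`.
rowOrder : ℕ → ℕ → ℕ × ℕ → Bool
rowOrder x y (a , b) = eqB (a <ᵇ x) (b <ᵇ y)

eqB-true⇒≡ : ∀ a b → eqB a b ≡ true → a ≡ b
eqB-true⇒≡ true  true  _ = refl
eqB-true⇒≡ false false _ = refl

eqB-refl : ∀ a → eqB a a ≡ true
eqB-refl true  = refl
eqB-refl false = refl

all-zip-nth : ∀ (f : ℕ × ℕ → Bool) xs ys {j} → all f (zip xs ys) ≡ true → j < length xs → j < length ys →
              f (nth xs j , nth ys j) ≡ true
all-zip-nth f (x ∷ xs) (y ∷ ys) {zero}  e _       _       = ∧-conicalˡ (f (x , y)) _ e
all-zip-nth f (x ∷ xs) (y ∷ ys) {suc j} e (s≤s p) (s≤s q) = all-zip-nth f xs ys (∧-conicalʳ (f (x , y)) _ e) p q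

sameOrder⇒comparisons : ∀ s t → sameOrder s t ≡ true → ∀ {i j} → i < j → j < length s → j < length t →
                        (nth s j <ᵇ nth s i) ≡ (nth t j <ᵇ nth t i)
sameOrder⇒comparisons (x ∷ s) (y ∷ t) e {zero}  {suc j} _ (s≤s p) (s≤s q) =
  eqB-true⇒≡ _ _ (all-zip-nth (rowOrder x y) s t (∧-conicalˡ (all (rowOrder x y) (zip s t)) _ e) p q)
sameOrder⇒comparisons (x ∷ s) (y ∷ t) e {suc i} {suc j} (s≤s i<j) (s≤s p) (s≤s q) =
  sameOrder⇒comparisons s t (∧-conicalʳ (all (rowOrder x y) (zip s t)) _ e) i<j p q

-- The index bounds are implicit arguments of type `T b`, filled in by evaluation when the indices are literals.
misordered : ∀ s t i j {_ : T (i <ᵇ j)} {_ : T (j <ᵇ length s)} {_ : T (j <ᵇ length t)} →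
             (nth s j <ᵇ nth s i) ≡ not (nth t j <ᵇ nth t i) → sameOrder s t ≡ false
misordered s t i j {i<j} {j<s} {j<t} flipped with sameOrder s t in e
... | false = refl
... | true  = ⊥-elim (not-¬ (sameOrder⇒comparisons s t e (<ᵇ⇒< i j i<j) (<ᵇ⇒< j (length s) j<s) (<ᵇ⇒< j (length t) j<t)) flipped)

row-transport : ∀ a b c u v t → length u ≡ length v → all (rowOrder a b) (zip u v) ≡ true →
                all (rowOrder a c) (zip u t) ≡ all (rowOrder b c) (zip v t)
row-transport a b c []      []      t       _   _ = refl
row-transport a b c (x ∷ u) (y ∷ v) []      _   _ = refl
row-transport a b c (x ∷ u) (y ∷ v) (z ∷ t) len e =
  cong₂ _∧_ (cong (λ q → eqB q (z <ᵇ c)) (eqB-true⇒≡ (x <ᵇ a) (y <ᵇ b) (∧-conicalˡ (rowOrder a b (x , y)) _ e)))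
            (row-transport a b c u v t (suc-injective len) (∧-conicalʳ (rowOrder a b (x , y)) _ e))

sameOrder-transport : ∀ u v t → length u ≡ length v → sameOrder u v ≡ true → sameOrder u t ≡ sameOrder v t
sameOrder-transport []      []      t       _   _ = refl
sameOrder-transport (x ∷ u) (y ∷ v) []      _   _ = refl
sameOrder-transport (x ∷ u) (y ∷ v) (z ∷ t) len e =
  cong₂ _∧_ (row-transport x y z u v t (suc-injective len) (∧-conicalˡ (all (rowOrder x y) (zip u v)) _ e))
            (sameOrder-transport u v t (suc-injective len) (∧-conicalʳ (all (rowOrder x y) (zip u v)) _ e))

row-refl : ∀ a xs → all (rowOrder a a) (zip xs xs) ≡ true
row-refl a []       = refl
row-refl a (x ∷ xs) = ∧-intro (eqB-refl (x <ᵇ a)) (row-refl a xs)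

sameOrder-refl : ∀ s → sameOrder s s ≡ true
sameOrder-refl []      = refl
sameOrder-refl (x ∷ s) = ∧-intro (row-refl x s) (sameOrder-refl s)

SameSide : ℕ → ℕ → ℕ → Set
SameSide y y' z = (z <ᵇ y) ≡ (z <ᵇ y') × (y <ᵇ z) ≡ (y' <ᵇ z)

sameSide-below : ∀ {b y y' z} → y < b → y' < b → b ≤ z → SameSide y y' z
sameSide-below y<b y'<b b≤z = trans (≤⇒<ᵇ≡false (≤-trans (<⇒≤ y<b) b≤z)) (sym (≤⇒<ᵇ≡false (≤-trans (<⇒≤ y'<b) b≤z)))
                            , trans (<⇒<ᵇ≡true (<-≤-trans y<b b≤z)) (sym (<⇒<ᵇ≡true (<-≤-trans y'<b b≤z)))

row-replaced : ∀ a pre y y' suf → (y <ᵇ a) ≡ (y' <ᵇ a) →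
               all (rowOrder a a) (zip (pre ++ y ∷ suf) (pre ++ y' ∷ suf)) ≡ true
row-replaced a []        y y' suf e = ∧-intro (subst (λ q → eqB (y <ᵇ a) q ≡ true) e (eqB-refl (y <ᵇ a))) (row-refl a suf)
row-replaced a (x ∷ pre) y y' suf e = ∧-intro (eqB-refl (x <ᵇ a)) (row-replaced a pre y y' suf e)

row-replacing : ∀ y y' suf → All (SameSide y y') suf → all (rowOrder y y') (zip suf suf) ≡ true
row-replacing y y' []        []                    = refl
row-replacing y y' (z ∷ suf) ((below , _) ∷ sides) =
  ∧-intro (subst (λ q → eqB (z <ᵇ y) q ≡ true) below (eqB-refl (z <ᵇ y))) (row-replacing y y' suf sides)

sameOrder-replace : ∀ pre y y' suf → All (SameSide y y') pre → All (SameSide y y') suf →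
                    sameOrder (pre ++ y ∷ suf) (pre ++ y' ∷ suf) ≡ true
sameOrder-replace []        y y' suf []                  sides = ∧-intro (row-replacing y y' suf sides) (sameOrder-refl suf)
sameOrder-replace (x ∷ pre) y y' suf ((_ , above) ∷ pres) sides =
  ∧-intro (row-replaced x pre y y' suf above) (sameOrder-replace pre y y' suf pres sides)

row-map-+ : ∀ k x y xs ys → all (rowOrder (k + x) y) (zip (map (k +_) xs) ys) ≡ all (rowOrder x y) (zip xs ys)
row-map-+ k x y []       ys       = refl
row-map-+ k x y (a ∷ xs) []       = refl
row-map-+ k x y (a ∷ xs) (b ∷ ys) = cong₂ (λ c → _∧_ (eqB c (b <ᵇ y))) (<ᵇ-+ k a x) (row-map-+ k x y xs ys)

sameOrder-map-+ : ∀ k s t → sameOrder (map (k +_) s) t ≡ sameOrder s t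
sameOrder-map-+ k []      t       = refl
sameOrder-map-+ k (x ∷ s) []      = refl
sameOrder-map-+ k (x ∷ s) (y ∷ t) = cong₂ _∧_ (row-map-+ k x y s t) (sameOrder-map-+ k s t)

contains-map-+ : ∀ k w τ → contains (map (k +_) w) τ ≡ contains w τ
contains-map-+ k w τ = trans (anySubseq-map (k +_) (length τ) (occurs τ) w)
                             (any-cong (λ s → sameOrder-map-+ k s τ) (subseqs (length τ) w))

-- The pattern 2431 in the one-line form

contains2431-drop21 : ∀ B R → 3 ≤ B → All (3 ≤_) R → contains (2 ∷ B ∷ 1 ∷ R) p2431 ≡ contains (B ∷ R) p2431
contains2431-drop21 B R 3≤B 3≤R = expand
  where
  p : List ℕ → Bool
  p = occurs p2431
  2≱ : ∀ {x} → 3 ≤ x → (x <ᵇ 2) ≡ false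
  2≱ 3≤x = ≤⇒<ᵇ≡false (≤-trans (n≤1+n 2) 3≤x)
  starts-2B1 : ∀ s → All (3 ≤_) s → length s ≡ 1 → p (2 ∷ B ∷ 1 ∷ s) ≡ false
  starts-2B1 (x ∷ []) (3≤x ∷ []) refl = misordered (2 ∷ B ∷ 1 ∷ x ∷ []) p2431 0 3 (2≱ 3≤x)
  starts-2B : ∀ s → All (3 ≤_) s → length s ≡ 2 → p (2 ∷ B ∷ s) ≡ false
  starts-2B (x ∷ y ∷ []) (_ ∷ 3≤y ∷ []) refl = misordered (2 ∷ B ∷ x ∷ y ∷ []) p2431 0 3 (2≱ 3≤y)
  starts-21 : ∀ s → All (3 ≤_) s → length s ≡ 2 → p (2 ∷ 1 ∷ s) ≡ false
  starts-21 (x ∷ y ∷ []) _ refl = misordered (2 ∷ 1 ∷ x ∷ y ∷ []) p2431 0 1 refl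
  starts-2 : ∀ s → All (3 ≤_) s → length s ≡ 3 → p (2 ∷ s) ≡ false
  starts-2 (x ∷ y ∷ z ∷ []) (_ ∷ _ ∷ 3≤z ∷ []) refl = misordered (2 ∷ x ∷ y ∷ z ∷ []) p2431 0 3 (2≱ 3≤z)
  starts-B1 : ∀ s → All (3 ≤_) s → length s ≡ 2 → p (B ∷ 1 ∷ s) ≡ false
  starts-B1 (x ∷ y ∷ []) _ refl = misordered (B ∷ 1 ∷ x ∷ y ∷ []) p2431 0 1 (<⇒<ᵇ≡true (≤-trans (s≤s (s≤s z≤n)) 3≤B))
  starts-1 : ∀ s → All (3 ≤_) s → length s ≡ 3 → p (1 ∷ s) ≡ false
  starts-1 (x ∷ y ∷ z ∷ []) (_ ∷ _ ∷ 3≤z ∷ []) refl = misordered (1 ∷ x ∷ y ∷ z ∷ []) p2431 0 3 (≤⇒<ᵇ≡false (≤-trans (s≤s z≤n) 3≤z))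
  -- Expanding the choices of 2, B and 1 leaves six kinds of candidates that use 2 or 1, each refuted above.
  expand : anySubseq 4 p (2 ∷ B ∷ 1 ∷ R) ≡ anySubseq 4 p (B ∷ R)
  expand
    rewrite anySubseq-∷ 3 p 2 (B ∷ 1 ∷ R) | anySubseq-∷ 2 (λ s → p (2 ∷ s)) B (1 ∷ R)
          | anySubseq-∷ 1 (λ s → p (2 ∷ B ∷ s)) 1 R | anySubseq-∷ 2 (λ s → p (2 ∷ s)) 1 R
          | anySubseq-∷ 3 p B (1 ∷ R) | anySubseq-∷ 2 (λ s → p (B ∷ s)) 1 R
          | anySubseq-∷ 3 p 1 R | anySubseq-∷ 3 p B R
          | anySubseq-false (3 ≤_) 1 (λ s → p (2 ∷ B ∷ 1 ∷ s)) R 3≤R starts-2B1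
          | anySubseq-false (3 ≤_) 2 (λ s → p (2 ∷ B ∷ s)) R 3≤R starts-2B
          | anySubseq-false (3 ≤_) 2 (λ s → p (2 ∷ 1 ∷ s)) R 3≤R starts-21
          | anySubseq-false (3 ≤_) 3 (λ s → p (2 ∷ s)) R 3≤R starts-2
          | anySubseq-false (3 ≤_) 2 (λ s → p (B ∷ 1 ∷ s)) R 3≤R starts-B1
          | anySubseq-false (3 ≤_) 3 (λ s → p (1 ∷ s)) R 3≤R starts-1
    = refl

avoids2431-grow : ∀ {m v₁ vs} → IsPermutation m (v₁ ∷ vs) → avoids (grow (v₁ ∷ vs)) p2431 ≡ avoids (v₁ ∷ vs) p2431
avoids2431-grow {m} {v₁} {vs} π with ⊆range⇒positive m (v₁ ∷ vs) (⊆range π)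
... | 1≤v₁ ∷ 1≤vs =
  cong not (trans (contains2431-drop21 (2 + v₁) (map (2 +_) vs) (s≤s (s≤s 1≤v₁)) (map⁺ (All.map (λ h → s≤s (s≤s h)) 1≤vs)))
                  (contains-map-+ 2 (v₁ ∷ vs) p2431))

-- The pattern 1324 in the cycle forms

occurs-replace-small : ∀ τ pre y y' suf → y < 4 → y' < 4 → All (4 ≤_) pre → All (4 ≤_) suf →
                       occurs τ (pre ++ y ∷ suf) ≡ occurs τ (pre ++ y' ∷ suf)
occurs-replace-small τ pre y y' suf y<4 y'<4 4≤pre 4≤suf =
  sameOrder-transport (pre ++ y ∷ suf) (pre ++ y' ∷ suf) τ (trans (length-++ pre) (sym (length-++ pre)))
    (sameOrder-replace pre y y' suf (All.map (sameSide-below y<4 y'<4) 4≤pre) (All.map (sameSide-below y<4 y'<4) 4≤suf))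

occurs1324-adjacent-small : ∀ pre y z suf → y < 4 → All (4 ≤_) pre → All (z <_) suf →
                            suc (suc (length suf)) + length pre ≡ 4 → occurs p1324 (pre ++ y ∷ z ∷ suf) ≡ false
occurs1324-adjacent-small []           y z (x ∷ w ∷ []) _   []        (z<x ∷ _) refl =
  misordered (y ∷ z ∷ x ∷ w ∷ []) p1324 1 2 (≤⇒<ᵇ≡false (<⇒≤ z<x))
occurs1324-adjacent-small (a ∷ [])     y z (x ∷ [])     y<4 (4≤a ∷ _) _         refl =
  misordered (a ∷ y ∷ z ∷ x ∷ []) p1324 0 1 (<⇒<ᵇ≡true (<-≤-trans y<4 4≤a))
occurs1324-adjacent-small (a ∷ b ∷ []) y z []           y<4 (4≤a ∷ _) _         refl =
  misordered (a ∷ b ∷ y ∷ z ∷ []) p1324 0 2 (<⇒<ᵇ≡true (<-≤-trans y<4 4≤a))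
occurs1324-adjacent-small []                y z []              _ _ _ ()
occurs1324-adjacent-small (_ ∷ [])          y z []              _ _ _ ()
occurs1324-adjacent-small (_ ∷ _ ∷ _ ∷ _)   y z []              _ _ _ ()
occurs1324-adjacent-small []                y z (_ ∷ [])        _ _ _ ()
occurs1324-adjacent-small (_ ∷ _ ∷ _)       y z (_ ∷ [])        _ _ _ ()
occurs1324-adjacent-small (_ ∷ _)           y z (_ ∷ _ ∷ [])    _ _ _ ()
occurs1324-adjacent-small _                 y z (_ ∷ _ ∷ _ ∷ _) _ _ _ ()

contains1324-collapse : ∀ A B → All (4 ≤_) A → All (4 ≤_) B →
                        contains (A ++ 3 ∷ 1 ∷ 2 ∷ B) p1324 ≡ contains (A ++ 3 ∷ B) p1324
contains1324-collapse A B 4≤A 4≤B = collapse A 4 [] (occurs p1324) 4≤A [] refl (λ s → refl)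
  where
  2<B : All (2 <_) B
  2<B = All.map (≤-trans (s≤s (s≤s (s≤s z≤n)))) 4≤B
  -- `pre` holds the letters of a candidate occurrence already chosen from the part of A traversed so far.
  collapse : ∀ A k pre (p : List ℕ → Bool) → All (4 ≤_) A → All (4 ≤_) pre → k + length pre ≡ 4 →
             (∀ s → p s ≡ occurs p1324 (pre ++ s)) → anySubseq k p (A ++ 3 ∷ 1 ∷ 2 ∷ B) ≡ anySubseq k p (A ++ 3 ∷ B)
  collapse A       zero    pre p _             _     _   _  = refl
  collapse []      (suc k) pre p _             4≤pre len p≗ = begin
    anySubseq (suc k) p (3 ∷ 1 ∷ 2 ∷ B)                      ≡⟨ anySubseq-∷ k p 3 (1 ∷ 2 ∷ B) ⟩
    after 3 (1 ∷ 2 ∷ B) ∨ anySubseq (suc k) p (1 ∷ 2 ∷ B)    ≡⟨ cong (after 3 (1 ∷ 2 ∷ B) ∨_) (anySubseq-∷ k p 1 (2 ∷ B)) ⟩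
    after 3 (1 ∷ 2 ∷ B) ∨ (after 1 (2 ∷ B) ∨ anySubseq (suc k) p (2 ∷ B))
                                     ≡⟨ cong (λ b → after 3 (1 ∷ 2 ∷ B) ∨ (after 1 (2 ∷ B) ∨ b)) (anySubseq-∷ k p 2 B) ⟩
    after 3 (1 ∷ 2 ∷ B) ∨ (after 1 (2 ∷ B) ∨ (after 2 B ∨ Y))
                                     ≡⟨ cong₂ (λ a b → a ∨ (b ∨ (after 2 B ∨ Y))) 312→3 12→3 ⟩
    X ∨ (X ∨ (after 2 B ∨ Y))        ≡⟨ cong (λ a → X ∨ (X ∨ (a ∨ Y))) 2→3 ⟩
    X ∨ (X ∨ (X ∨ Y))                ≡⟨ trans (∨-dup X (X ∨ Y)) (∨-dup X Y) ⟩
    X ∨ Y                            ≡⟨ sym (anySubseq-∷ k p 3 B) ⟩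
    anySubseq (suc k) p (3 ∷ B)      ∎
    where
    after : ℕ → List ℕ → Bool
    after y = anySubseq k (λ s → p (y ∷ s))
    X = after 3 B
    Y = anySubseq (suc k) p B
    adjacent : ∀ y z → y < 4 → ∀ s → All (z <_) s → suc (length s) ≡ k → p (y ∷ z ∷ s) ≡ false
    adjacent y z y<4 s z<s len-s =
      trans (p≗ (y ∷ z ∷ s)) (occurs1324-adjacent-small pre y z s y<4 4≤pre z<s (subst (λ j → suc j + length pre ≡ 4) (sym len-s) len))
    replace : ∀ y → y < 4 → ∀ s → All (4 ≤_) s → length s ≡ k → p (y ∷ s) ≡ p (3 ∷ s)
    replace y y<4 s 4≤s _ = trans (p≗ (y ∷ s)) (trans (occurs-replace-small p1324 pre y 3 s y<4 ≤-refl 4≤pre 4≤s) (sym (p≗ (3 ∷ s))))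
    312→3 : after 3 (1 ∷ 2 ∷ B) ≡ X
    312→3 = trans (anySubseq-skipHead (1 <_) k (λ s → p (3 ∷ s)) 1 (2 ∷ B) (s≤s (s≤s z≤n) ∷ All.map (<-≤-trans (s≤s (s≤s z≤n))) 2<B)
                                      (adjacent 3 1 ≤-refl))
                  (anySubseq-skipHead (2 <_) k (λ s → p (3 ∷ s)) 2 B 2<B (adjacent 3 2 ≤-refl))
    12→3 : after 1 (2 ∷ B) ≡ X
    12→3 = trans (anySubseq-skipHead (2 <_) k (λ s → p (1 ∷ s)) 2 B 2<B (adjacent 1 2 (s≤s (s≤s z≤n))))
                 (anySubseq-cong (4 ≤_) k (λ s → p (1 ∷ s)) (λ s → p (3 ∷ s)) B 4≤B (replace 1 (s≤s (s≤s z≤n))))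
    2→3 : after 2 B ≡ X
    2→3 = anySubseq-cong (4 ≤_) k (λ s → p (2 ∷ s)) (λ s → p (3 ∷ s)) B 4≤B (replace 2 (s≤s (s≤s (s≤s z≤n))))
  collapse (x ∷ A) (suc k) pre p (4≤x ∷ 4≤A) 4≤pre len p≗ = begin
    anySubseq (suc k) p (x ∷ A ++ 3 ∷ 1 ∷ 2 ∷ B)         ≡⟨ anySubseq-∷ k p x (A ++ 3 ∷ 1 ∷ 2 ∷ B) ⟩
    anySubseq k (λ s → p (x ∷ s)) (A ++ 3 ∷ 1 ∷ 2 ∷ B) ∨ anySubseq (suc k) p (A ++ 3 ∷ 1 ∷ 2 ∷ B)
      ≡⟨ cong₂ _∨_ (collapse A k (pre ++ x ∷ []) (λ s → p (x ∷ s)) 4≤A (++⁺ 4≤pre (4≤x ∷ [])) len′ p≗′)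
                   (collapse A (suc k) pre p 4≤A 4≤pre len p≗) ⟩
    anySubseq k (λ s → p (x ∷ s)) (A ++ 3 ∷ B) ∨ anySubseq (suc k) p (A ++ 3 ∷ B)
      ≡⟨ sym (anySubseq-∷ k p x (A ++ 3 ∷ B)) ⟩
    anySubseq (suc k) p (x ∷ A ++ 3 ∷ B)                 ∎
    where
    len′ : k + length (pre ++ x ∷ []) ≡ 4
    len′ = trans (cong (k +_) (trans (length-++ pre) (+-comm (length pre) 1))) (trans (+-suc k (length pre)) len)
    p≗′ : ∀ s → p (x ∷ s) ≡ occurs p1324 ((pre ++ x ∷ []) ++ s)
    p≗′ s = trans (p≗ (x ∷ s)) (cong (occurs p1324) (sym (++-assoc pre (x ∷ []) s)))

occurs1324-last-max : ∀ a b c d → d < a ⊎ d < b ⊎ d < c → occurs p1324 (a ∷ b ∷ c ∷ d ∷ []) ≡ false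
occurs1324-last-max a b c d (inj₁ d<a)        = misordered (a ∷ b ∷ c ∷ d ∷ []) p1324 0 3 (<⇒<ᵇ≡true d<a)
occurs1324-last-max a b c d (inj₂ (inj₁ d<b)) = misordered (a ∷ b ∷ c ∷ d ∷ []) p1324 1 3 (<⇒<ᵇ≡true d<b)
occurs1324-last-max a b c d (inj₂ (inj₂ d<c)) = misordered (a ∷ b ∷ c ∷ d ∷ []) p1324 2 3 (<⇒<ᵇ≡true d<c)

module _ (X : List ℕ) (4≤X : All (4 ≤_) X) where
  private
    p = occurs p1324

    drop3 : ∀ k q → (∀ s → All (4 ≤_) s → suc (length s) ≡ k → q (s ++ 3 ∷ []) ≡ false) →
            anySubseq k q (X ++ 3 ∷ []) ≡ anySubseq k q X
    drop3 k q = anySubseq-skipLast (4 ≤_) k q 3 X 4≤X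

    drop1 : ∀ k q → (∀ s → All (1 <_) s → suc (length s) ≡ k → q (s ++ 1 ∷ []) ≡ false) →
            anySubseq k q ((X ++ 3 ∷ []) ++ 1 ∷ []) ≡ anySubseq k q (X ++ 3 ∷ [])
    drop1 k q = anySubseq-skipLast (1 <_) k q 1 (X ++ 3 ∷ []) (++⁺ (All.map (≤-trans (s≤s (s≤s z≤n))) 4≤X) (s≤s (s≤s z≤n) ∷ []))

  contains1324-drop-last3 : contains (1 ∷ 2 ∷ X ++ 3 ∷ []) p1324 ≡ contains (1 ∷ 2 ∷ X) p1324
  contains1324-drop-last3 =
    anySubseq-∷-cong 3 p 1 (2 ∷ X ++ 3 ∷ []) (2 ∷ X)
      (anySubseq-∷-cong 2 (λ s → p (1 ∷ s)) 2 (X ++ 3 ∷ []) X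
         (drop3 2 (λ s → p (1 ∷ 2 ∷ s)) λ { (x ∷ []) (4≤x ∷ []) refl → occurs1324-last-max 1 2 x 3 (inj₂ (inj₂ 4≤x)) })
         (drop3 3 (λ s → p (1 ∷ s))     λ { (x ∷ y ∷ []) (4≤x ∷ _) refl → occurs1324-last-max 1 x y 3 (inj₂ (inj₁ 4≤x)) }))
      (anySubseq-∷-cong 3 p 2 (X ++ 3 ∷ []) X
         (drop3 3 (λ s → p (2 ∷ s))     λ { (x ∷ y ∷ []) (4≤x ∷ _) refl → occurs1324-last-max 2 x y 3 (inj₂ (inj₁ 4≤x)) })
         (drop3 4 p                     λ { (x ∷ y ∷ z ∷ []) (4≤x ∷ _) refl → occurs1324-last-max x y z 3 (inj₁ 4≤x) }))

  contains1324-drop-last31 : contains (2 ∷ (X ++ 3 ∷ []) ++ 1 ∷ []) p1324 ≡ contains (2 ∷ X) p1324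
  contains1324-drop-last31 =
    anySubseq-∷-cong 3 p 2 ((X ++ 3 ∷ []) ++ 1 ∷ []) X
      (trans (drop1 3 (λ s → p (2 ∷ s)) λ { (x ∷ y ∷ []) _ refl → occurs1324-last-max 2 x y 1 (inj₁ ≤-refl) })
             (drop3 3 (λ s → p (2 ∷ s)) λ { (x ∷ y ∷ []) (4≤x ∷ _) refl → occurs1324-last-max 2 x y 3 (inj₂ (inj₁ 4≤x)) }))
      (trans (drop1 4 p                 λ { (x ∷ y ∷ z ∷ []) (1<x ∷ _) refl → occurs1324-last-max x y z 1 (inj₁ 1<x) })
             (drop3 4 p                 λ { (x ∷ y ∷ z ∷ []) (4≤x ∷ _) refl → occurs1324-last-max x y z 3 (inj₁ 4≤x) }))

rotate : ℕ → List ℕ → List ℕ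
rotate i c = drop i c ++ take i c

rotate-zero : ∀ c → rotate 0 c ≡ c
rotate-zero c = ++-identityʳ c

rotate-length : ∀ c → rotate (length c) c ≡ c
rotate-length c rewrite drop-all (length c) c ≤-refl | take-all (length c) c ≤-refl = refl

rotate-grownCycle : ∀ cs j → j ≤ length cs →
                    rotate (2 + j) (grownCycle cs) ≡ drop j (map (2 +_) cs) ++ 3 ∷ 1 ∷ 2 ∷ take j (map (2 +_) cs)
rotate-grownCycle cs j j≤ = begin
  drop j (X ++ 3 ∷ []) ++ 1 ∷ 2 ∷ take j (X ++ 3 ∷ [])
    ≡⟨ cong₂ (λ u t → u ++ 1 ∷ 2 ∷ t) (drop-++ˡ j X (3 ∷ []) j≤X) (take-++ˡ j X (3 ∷ []) j≤X) ⟩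
  (drop j X ++ 3 ∷ []) ++ 1 ∷ 2 ∷ take j X
    ≡⟨ ++-assoc (drop j X) (3 ∷ []) _ ⟩
  drop j X ++ 3 ∷ 1 ∷ 2 ∷ take j X
    ∎
  where
  X = map (2 +_) cs
  j≤X : j ≤ length X
  j≤X = subst (j ≤_) (sym (length-map (2 +_) cs)) j≤

contains1324-rotate-grownCycle : ∀ cs j → All (2 ≤_) cs → j ≤ length cs →
                                 contains (rotate (2 + j) (grownCycle cs)) p1324 ≡ contains (rotate (suc j) (1 ∷ cs)) p1324
contains1324-rotate-grownCycle cs j 2≤cs j≤ = begin
  contains (rotate (2 + j) (grownCycle cs)) p1324                ≡⟨ cong (λ w → contains w p1324) (rotate-grownCycle cs j j≤) ⟩
  contains (drop j X ++ 3 ∷ 1 ∷ 2 ∷ take j X) p1324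
    ≡⟨ contains1324-collapse (drop j X) (take j X) (drop⁺ j 4≤X) (take⁺ j 4≤X) ⟩
  contains (drop j X ++ 3 ∷ take j X) p1324                      ≡⟨ cong (λ w → contains w p1324) shifted ⟩
  contains (map (2 +_) (drop j cs ++ 1 ∷ take j cs)) p1324       ≡⟨ contains-map-+ 2 (drop j cs ++ 1 ∷ take j cs) p1324 ⟩
  contains (rotate (suc j) (1 ∷ cs)) p1324                       ∎
  where
  X = map (2 +_) cs
  4≤X : All (4 ≤_) X
  4≤X = map⁺ (All.map (λ h → s≤s (s≤s h)) 2≤cs)
  shifted : drop j X ++ 3 ∷ take j X ≡ map (2 +_) (drop j cs ++ 1 ∷ take j cs)
  shifted = trans (cong₂ (λ u t → u ++ 3 ∷ t) (drop-map j cs) (take-map j cs)) (sym (map-++ (2 +_) (drop j cs) (1 ∷ take j cs)))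

RotationsAvoid : List ℕ → List ℕ → Set
RotationsAvoid τ c = ∀ i → i < length c → contains (rotate i c) τ ≡ false

cycleForms-avoid⇒ : ∀ τ c → all (λ w → avoids w τ) (cycleForms c) ≡ true → RotationsAvoid τ c
cycleForms-avoid⇒ τ c a i i< =
  not-injective (applyUpTo⁻ {P = λ i → avoids (rotate i c) τ ≡ true} (λ i → i) (length c) (map⁻ (all⁻ _ (cycleForms c) a)) i<)

cycleForms-avoid⇐ : ∀ τ c → RotationsAvoid τ c → all (λ w → avoids w τ) (cycleForms c) ≡ true
cycleForms-avoid⇐ τ c h =
  all⁺ (map⁺ (applyUpTo⁺₁ {P = λ i → avoids (rotate i c) τ ≡ true} (λ i → i) (length c) (λ i< → cong not (h _ i<))))

rotationsAvoid-≤ : ∀ τ x c → RotationsAvoid τ (x ∷ c) → ∀ i → i ≤ length (x ∷ c) → contains (rotate i (x ∷ c)) τ ≡ false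
rotationsAvoid-≤ τ x c h i i≤ with m≤n⇒m<n∨m≡n i≤
... | inj₁ i<   = h i i<
... | inj₂ refl = trans (cong (λ w → contains w τ) (trans (rotate-length (x ∷ c)) (sym (rotate-zero (x ∷ c))))) (h 0 (s≤s z≤n))

length-grownCycle : ∀ cs → length (grownCycle cs) ≡ 3 + length cs
length-grownCycle cs =
  cong (2 +_) (trans (length-++ (map (2 +_) cs)) (trans (cong (_+ 1) (length-map (2 +_) cs)) (+-comm (length cs) 1)))

module _ (cs : List ℕ) (2≤cs : All (2 ≤_) cs) where
  private
    X = map (2 +_) cs
    4≤X : All (4 ≤_) X
    4≤X = map⁺ (All.map (λ h → s≤s (s≤s h)) 2≤cs)
    grown-index : ∀ {j} → 2 + j < length (grownCycle cs) → j ≤ length cs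
    grown-index {j} j< = s≤s⁻¹ (s≤s⁻¹ (s≤s⁻¹ (subst (2 + j <_) (length-grownCycle cs) j<)))
    12X-avoided : RotationsAvoid p1324 (1 ∷ cs) → contains (1 ∷ 2 ∷ X) p1324 ≡ false
    12X-avoided h = anySubseq-∷-false 3 (occurs p1324) 3 (1 ∷ 2 ∷ X) (begin
      contains (3 ∷ 1 ∷ 2 ∷ X) p1324       ≡⟨ contains1324-collapse [] X [] 4≤X ⟩
      contains (map (2 +_) (1 ∷ cs)) p1324 ≡⟨ contains-map-+ 2 (1 ∷ cs) p1324 ⟩
      contains (1 ∷ cs) p1324              ≡⟨ cong (λ w → contains w p1324) (sym (rotate-zero (1 ∷ cs))) ⟩
      contains (rotate 0 (1 ∷ cs)) p1324   ≡⟨ h 0 (s≤s z≤n) ⟩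
      false                                ∎)

  rotationsAvoid-grownCycle : RotationsAvoid p1324 (1 ∷ cs) → RotationsAvoid p1324 (grownCycle cs)
  rotationsAvoid-grownCycle h zero          _  = trans (cong (λ w → contains w p1324) (rotate-zero (grownCycle cs)))
                                                   (trans (contains1324-drop-last3 X 4≤X) (12X-avoided h))
  rotationsAvoid-grownCycle h (suc zero)    _  = trans (contains1324-drop-last31 X 4≤X)
                                                   (anySubseq-∷-false 3 (occurs p1324) 1 (2 ∷ X) (12X-avoided h))
  rotationsAvoid-grownCycle h (suc (suc j)) j< = trans (contains1324-rotate-grownCycle cs j 2≤cs (grown-index j<))
                                                   (rotationsAvoid-≤ p1324 1 cs h (suc j) (s≤s (grown-index j<)))

  rotationsAvoid-grownCycle⁻ : RotationsAvoid p1324 (grownCycle cs) → RotationsAvoid p1324 (1 ∷ cs)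
  rotationsAvoid-grownCycle⁻ h zero    _       = begin
    contains (rotate 0 (1 ∷ cs)) p1324
      ≡⟨ cong (λ w → contains w p1324) (trans (rotate-zero (1 ∷ cs)) (sym (rotate-length (1 ∷ cs)))) ⟩
    contains (rotate (suc (length cs)) (1 ∷ cs)) p1324
      ≡⟨ sym (contains1324-rotate-grownCycle cs (length cs) 2≤cs ≤-refl) ⟩
    contains (rotate (2 + length cs) (grownCycle cs)) p1324
      ≡⟨ h (2 + length cs) (subst (2 + length cs <_) (sym (length-grownCycle cs)) ≤-refl) ⟩
    false
      ∎
  rotationsAvoid-grownCycle⁻ h (suc j) (s≤s j<) =
    trans (sym (contains1324-rotate-grownCycle cs j 2≤cs (<⇒≤ j<)))
          (h (2 + j) (subst (2 + j <_) (sym (length-grownCycle cs)) (s≤s (s≤s (s≤s (<⇒≤ j<))))))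

-- The bijection

record InA° (n : ℕ) (σ τ w : List ℕ) : Set where
  field
    permutation : IsPermutation n w
    cyclic      : distinct (stdCycle n w) ≡ true
    avoids-σ    : avoids w σ ≡ true
    forms-avoid : RotationsAvoid τ (stdCycle n w)
open InA°

inA⇒ : ∀ n σ τ w → T (inA n σ τ w) → InA° n σ τ w
inA⇒ n σ τ w t = record
  { permutation = isPerm⇒ n w (∧-conicalˡ (isPerm n w) _ cyc)
  ; cyclic      = ∧-conicalʳ (isPerm n w) _ cyc
  ; avoids-σ    = ∧-conicalˡ (avoids w σ) _ pats
  ; forms-avoid = cycleForms-avoid⇒ τ (stdCycle n w) (∧-conicalʳ (avoids w σ) _ pats)
  }
  where
  e    = Equivalence.to T-≡ t
  cyc  = ∧-conicalˡ (isCyclic n w) _ e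
  pats = ∧-conicalʳ (isCyclic n w) _ e

inA⇐ : ∀ n σ τ w → InA° n σ τ w → T (inA n σ τ w)
inA⇐ n σ τ w I = Equivalence.from T-≡ (∧-intro (∧-intro (isPerm⇐ n w (permutation I)) (cyclic I))
                                               (∧-intro (avoids-σ I) (cycleForms-avoid⇐ τ (stdCycle n w) (forms-avoid I))))

inA-restr⇒ : ∀ n σ τ w → T (inA n σ τ w ∧ restr n n w) → InA° n σ τ w × restr n n w ≡ true
inA-restr⇒ n σ τ w t with Equivalence.to T-∧ t
... | i , r = inA⇒ n σ τ w i , Equivalence.to T-≡ r

inA-restr⇐ : ∀ n σ τ w → InA° n σ τ w → restr n n w ≡ true → T (inA n σ τ w ∧ restr n n w)
inA-restr⇐ n σ τ w I r = Equivalence.from T-∧ (inA⇐ n σ τ w I , Equivalence.from T-≡ r)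

grow-∈A° : ∀ m v → InA° (suc m) p2431 p1324 v →
           InA° (3 + m) p2431 p1324 (grow v) × restr (3 + m) (3 + m) (grow v) ≡ true
grow-∈A° m (v₁ ∷ vs) I = grown , ∧-intro refl (cong (_≡ᵇ 3) 3-last)
  where
  π = permutation I
  d = cyclic I
  O = orbit (v₁ ∷ vs) v₁ m
  shape = cyclic-grow π d
  O-positive = ⊆range⇒positive (suc m) O (orbit-⊆range π m v₁ (∧-conicalˡ (elem v₁ (range (suc m))) _ (⊆range π)))
  1∉O = distinct-head 1 O d
  grown : InA° (3 + m) p2431 p1324 (grow (v₁ ∷ vs))
  grown = record
    { permutation = grow-isPermutation π
    ; cyclic      = subst (λ c → distinct c ≡ true) (sym shape)
                          (distinct-grownCycle O (distinct-tail 1 O d) (positive⇒∉0 O-positive) 1∉O)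
    ; avoids-σ    = trans (avoids2431-grow π) (avoids-σ I)
    ; forms-avoid = subst (RotationsAvoid p1324) (sym shape)
                          (rotationsAvoid-grownCycle O (positive-∉1⇒≥2 O O-positive 1∉O) (forms-avoid I))
    }
  3-last : nth (stdCycle (3 + m) (grow (v₁ ∷ vs))) (2 + m) ≡ 3
  3-last = begin
    nth (stdCycle (3 + m) (grow (v₁ ∷ vs))) (2 + m)              ≡⟨ cong (λ c → nth c (2 + m)) shape ⟩
    nth (map (2 +_) O ++ 3 ∷ []) m                               ≡⟨ cong (nth (map (2 +_) O ++ 3 ∷ [])) len ⟩
    nth (map (2 +_) O ++ 3 ∷ []) (length (map (2 +_) O))         ≡⟨ nth-++-length (map (2 +_) O) 3 [] ⟩
    3                                                            ∎
    where
    len : m ≡ length (map (2 +_) O)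
    len = sym (trans (length-map (2 +_) O) (length-orbit (v₁ ∷ vs) v₁ m))

restr⇒ : ∀ n j w → restr n j w ≡ true → nth (stdCycle n w) 1 ≡ 2 × nth (stdCycle n w) (j ∸ 1) ≡ 3
restr⇒ n j w e = ≡ᵇ-true⇒≡ _ 2 (∧-conicalˡ (nth (stdCycle n w) 1 ≡ᵇ 2) _ e)
               , ≡ᵇ-true⇒≡ _ 3 (∧-conicalʳ (nth (stdCycle n w) 1 ≡ᵇ 2) _ e)

grow-∈A°⁻ : ∀ m v → InA° (3 + m) p2431 p1324 (grow v) → restr (3 + m) (3 + m) (grow v) ≡ true → InA° (suc m) p2431 p1324 v
grow-∈A°⁻ m (v₁ ∷ vs) I r = record
  { permutation = π
  ; cyclic      = ∧-intro (cong not 1∉O) (distinct-grownCycle⁻ O (subst (λ c → distinct c ≡ true) shape (cyclic I)))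
  ; avoids-σ    = trans (sym (avoids2431-grow π)) (avoids-σ I)
  ; forms-avoid = rotationsAvoid-grownCycle⁻ O 2≤O (subst (RotationsAvoid p1324) shape (forms-avoid I))
  }
  where
  π = grow-isPermutation⁻ (permutation I)
  O = orbit (v₁ ∷ vs) v₁ m
  closed = cyclic-grow⁻ π (cyclic I) (proj₂ (restr⇒ (3 + m) (3 + m) (grow (v₁ ∷ vs)) r))
  1∉O = proj₁ closed
  shape = stdCycle-grow π 1∉O (proj₂ closed)
  2≤O = positive-∉1⇒≥2 O (⊆range⇒positive (suc m) O (orbit-⊆range π m v₁ (∧-conicalˡ (elem v₁ (range (suc m))) _ (⊆range π)))) 1∉O

grown-shape : ∀ n b r → IsPermutation n (2 ∷ b ∷ 1 ∷ r) → 2 ∷ b ∷ 1 ∷ r ≡ grow (shrink (2 ∷ b ∷ 1 ∷ r))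
grown-shape n b r π with ⊆range⇒positive n (2 ∷ b ∷ 1 ∷ r) (⊆range π)
... | _ ∷ 1≤b ∷ _ ∷ 1≤r with positive-∉1⇒≥2 (b ∷ r) (1≤b ∷ 1≤r) 1∉br
  where
  d = distinct-tail 2 (b ∷ 1 ∷ r) (distinct≡ π)
  1∉br : elem 1 (b ∷ r) ≡ false
  1∉br = ∨-false⁺ (trans (≡ᵇ-sym 1 b) (∨-conicalˡ (b ≡ᵇ 1) _ (distinct-head b (1 ∷ r) d)))
                  (distinct-head 1 r (distinct-tail b (1 ∷ r) d))
... | 2≤b ∷ 2≤r = cong₂ (λ x xs → 2 ∷ x ∷ 1 ∷ xs) (sym (m+[n∸m]≡n 2≤b)) (sym (map-+-∸ 2 r 2≤r))

restricted-entries : ∀ m σ τ a b c r → InA° (3 + m) σ τ (a ∷ b ∷ c ∷ r) → restr (3 + m) (3 + m) (a ∷ b ∷ c ∷ r) ≡ true →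
                     a ≡ 2 × c ≡ 1
restricted-entries m σ τ a b c r I rs = proj₁ (restr⇒ (3 + m) (3 + m) w rs) , c≡1
  where
  w = a ∷ b ∷ c ∷ r
  iter-3 : iter w (2 + m) 1 ≡ 3
  iter-3 = trans (sym (nth-orbit w 1 {3 + m} {2 + m} ≤-refl)) (proj₂ (restr⇒ (3 + m) (3 + m) w rs))
  c≡1 : c ≡ 1
  c≡1 = trans (cong (app w) (sym iter-3)) (orbit-closes (permutation I) 1 (∈range⇐ (3 + m) 1 ≤-refl (s≤s z≤n)) (cyclic I))

restricted⇒grown : ∀ m σ τ w → InA° (3 + m) σ τ w → restr (3 + m) (3 + m) w ≡ true → w ≡ grow (shrink w)
restricted⇒grown m σ τ w I rs with length≡ (permutation I)  -- exposing the length rules out words shorter than 3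
restricted⇒grown m σ τ (a ∷ b ∷ c ∷ r) I rs | _ with restricted-entries m σ τ a b c r I rs
... | refl , refl = grown-shape (3 + m) b r (permutation I)

Σ-T-≡ : ∀ {f : List ℕ → Bool} {x y} → x ≡ y → (p : T (f x)) (q : T (f y)) →
        _≡_ {A = Σ (List ℕ) (λ z → T (f z))} (x , p) (y , q)
Σ-T-≡ refl p q = cong (_ ,_) (T-irrelevant p q)

A°restr↔A° : ∀ m → A°restr (3 + m) p2431 p1324 (3 + m) ↔ A° (suc m) p2431 p1324
A°restr↔A° m = mk↔ₛ′ shrink′ grow′ (λ (v , t) → Σ-T-≡ (shrink-grow v) _ t) (λ (w , t) → Σ-T-≡ (sym (grown w t)) _ t)
  where
  n = 3 + m
  grown : ∀ w → T (inA n p2431 p1324 w ∧ restr n n w) → w ≡ grow (shrink w)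
  grown w t = uncurry (restricted⇒grown m p2431 p1324 w) (inA-restr⇒ n p2431 p1324 w t)
  shrink′ : A°restr n p2431 p1324 n → A° (suc m) p2431 p1324
  shrink′ (w , t) =
    shrink w , inA⇐ (suc m) p2431 p1324 (shrink w) (uncurry (grow-∈A°⁻ m (shrink w)) (inA-restr⇒ n p2431 p1324 _ t′))
    where
    t′ = subst (λ u → T (inA n p2431 p1324 u ∧ restr n n u)) (grown w t) t
  grow′ : A° (suc m) p2431 p1324 → A°restr n p2431 p1324 n
  grow′ (v , t) = grow v , uncurry (inA-restr⇐ n p2431 p1324 (grow v)) (grow-∈A° m v (inA⇒ (suc m) p2431 p1324 v t))

-- The argument only needs 3 ≤ n.
lemma2p2 : (n : ℕ) → 5 ≤ n → A°restr n p2431 p1324 n ↔ A° (n ∸ 2) p2431 p1324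
lemma2p2 (suc (suc (suc m))) _ = A°restr↔A° m
lemma2p2 (suc zero)       (s≤s ())
lemma2p2 (suc (suc zero)) (s≤s (s≤s ()))
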